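{- Let $G$ be a co-chordal graph (i.e. $G^c$ is chordal) such that each vertex of $G$ lies in at most two maximal independent sets of $G$, and suppose $G^c$ has a clique tree $\mathcal{T}$ with $\chi_r'(\mathcal{T})=\lceil\log_2(\operatorname{mc}(G^c))\rceil$. Then $\operatorname{bc}(G)=\lceil\log_2(\operatorname{mc}(G^c))\rceil$.
   Context: A graph is chordal if it has no induced cycle of length greater than 3. A clique tree of a chordal graph $H$ is a tree whose vertices are exactly the maximal cliques of $H$ and which satisfies the clique-intersection property: for any two distinct maximal cliques $K^1,K^2$, every clique on the path between them contains $K^1\cap K^2$. $\operatorname{mc}(H)$ is the number of maximal cliques of $H$. $\operatorname{bc}(G)$ is the minimum number of complete bipartite subgraphs of $G$ covering all edges of $G$. For a tree $T=(V,E)$, an edge-ranking is a map $\varphi:E\to\{1,\dots,r\}$ such that any two distinct edges with equal label have an edge of larger label on the path between them; $\chi_r'(T)$ is the minimum $r$ over all edge-rankings. -}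

module Defs where

open import Data.Nat using (ℕ; zero; suc; _≤_; _<_)
open import Data.Nat.Logarithm using (⌈log₂_⌉) public
open import Data.Bool using (Bool; true; false; not; _∧_)
open import Data.Fin using (Fin; toℕ; _≟_)
open import Data.Fin.Subset using (Subset; _∈_; _∉_; _⊆_; _∩_)
open import Data.List using (List; []; _∷_; _++_; head; last; length)
open import Data.List.Relation.Unary.Linked using (Linked)
open import Data.List.Relation.Unary.Unique.Propositional using (Unique)
import Data.List.Membership.Propositional as LM
open import Data.Maybe using (just)
open import Data.Product using (Σ; ∃; _×_; _,_)
open import Data.Sum using (_⊎_)
open import Relation.Nullary using (¬_; Dec; yes; no)
open import Relation.Binary.PropositionalEquality using (_≡_; _≢_; refl; sym; cong₂)
open import Function.Definitions using (Injective)

record Graph (n : ℕ) : Set where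
  field
    adj    : Fin n → Fin n → Bool
    adj-sym    : ∀ i j → adj i j ≡ adj j i
    adj-irrefl : ∀ i → adj i i ≡ false
open Graph public

E : ∀ {n} → Graph n → Fin n → Fin n → Set
E G i j = adj G i j ≡ true

private
  eqb : ∀ {n} → Fin n → Fin n → Bool
  eqb i j with i ≟ j
  ... | yes _ = true
  ... | no  _ = false

  eqb-sym : ∀ {n} (i j : Fin n) → eqb i j ≡ eqb j i
  eqb-sym i j with i ≟ j | j ≟ i
  ... | yes _ | yes _ = refl
  ... | no _  | no _  = refl
  ... | yes p | no q  with q (sym p)
  ... | ()
  eqb-sym i j | no q | yes p with q (sym p)
  ... | ()

  eqb-refl : ∀ {n} (i : Fin n) → eqb i i ≡ true
  eqb-refl i with i ≟ i
  ... | yes _ = refl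
  ... | no q with q refl
  ... | ()

  ∧-false : ∀ b → b ∧ false ≡ false
  ∧-false true = refl
  ∧-false false = refl

complement : ∀ {n} → Graph n → Graph n
complement G = record
  { adj = λ i j → not (adj G i j) ∧ not (eqb i j)
  ; adj-sym = λ i j → cong₂ (λ a b → not a ∧ not b) (adj-sym G i j) (eqb-sym i j)
  ; adj-irrefl = λ i → helper i
  }
  where
    helper : ∀ i → not (adj G i i) ∧ not (eqb i i) ≡ false
    helper i with eqb i i | eqb-refl i
    ... | .true | refl = ∧-false (not (adj G i i))

IsClique : ∀ {n} → Graph n → Subset n → Set
IsClique G S = ∀ i j → i ∈ S → j ∈ S → i ≢ j → E G i j

IsMaxClique : ∀ {n} → Graph n → Subset n → Set
IsMaxClique G S = IsClique G S × (∀ S' → IsClique G S' → S ⊆ S' → S' ⊆ S)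

IsIndependent : ∀ {n} → Graph n → Subset n → Set
IsIndependent G S = ∀ i j → i ∈ S → j ∈ S → i ≢ j → adj G i j ≡ false

IsMaxIndependent : ∀ {n} → Graph n → Subset n → Set
IsMaxIndependent G S =
  IsIndependent G S × (∀ S' → IsIndependent G S' → S ⊆ S' → S' ⊆ S)

-- K : Fin m → Subset n is an enumeration (without repetition) of all
-- maximal cliques of H; hence mc(H) = m.
MaxCliqueEnum : ∀ {n} → Graph n → (m : ℕ) → (Fin m → Subset n) → Set
MaxCliqueEnum H m K =
  Injective _≡_ _≡_ K × (∀ i → IsMaxClique H (K i))
  × (∀ S → IsMaxClique H S → ∃ λ i → K i ≡ S)

-- i and j are consecutive on the cycle 0,1,...,k-1,0
CycAdj : (k : ℕ) → Fin k → Fin k → Set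
CycAdj k i j =
  suc (toℕ i) ≡ toℕ j ⊎ suc (toℕ j) ≡ toℕ i
  ⊎ (toℕ i ≡ 0 × suc (toℕ j) ≡ k) ⊎ (toℕ j ≡ 0 × suc (toℕ i) ≡ k)

InducedCycle : ∀ {n} → Graph n → ℕ → Set
InducedCycle {n} H k =
  Σ (Fin k → Fin n) λ c → Injective _≡_ _≡_ c ×
    (∀ i j → (E H (c i) (c j) → CycAdj k i j) × (CycAdj k i j → E H (c i) (c j)))

Chordal : ∀ {n} → Graph n → Set
Chordal H = ∀ k → 4 ≤ k → ¬ InducedCycle H k

PathBetween : ∀ {m} → Graph m → Fin m → Fin m → List (Fin m) → Set
PathBetween T u v p =
  Linked (E T) p × Unique p × head p ≡ just u × last p ≡ just v

Connected : ∀ {m} → Graph m → Set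
Connected T = ∀ u v → ∃ λ p → PathBetween T u v p

IsCycle : ∀ {m} → Graph m → List (Fin m) → Set
IsCycle T c =
  3 ≤ length c × Linked (E T) c × Unique c ×
  (∃ λ a → ∃ λ b → head c ≡ just a × last c ≡ just b × E T b a)

Acyclic : ∀ {m} → Graph m → Set
Acyclic T = ∀ c → ¬ IsCycle T c

IsTree : ∀ {m} → Graph m → Set
IsTree T = Connected T × Acyclic T

-- Clique trees: T is a tree on the maximal cliques K 0, ..., K (m-1)
-- of H satisfying the clique-intersection property.

IsCliqueTree : ∀ {n m} → Graph n → (Fin m → Subset n) → Graph m → Set
IsCliqueTree H K T =
  MaxCliqueEnum H _ K × IsTree T ×
  (∀ i j → i ≢ j → ∀ p → PathBetween T i j p →
     ∀ k → k LM.∈ p → (K i ∩ K j) ⊆ K k)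

-- Edge rankings.  φ u v is the label of the edge {u,v} (only its values
-- on edges matter; it must be symmetric there).

Consecutive : ∀ {A : Set} → A → A → List A → Set
Consecutive {A} x y p = ∃ λ (pre : List A) → ∃ λ suf → p ≡ pre ++ x ∷ y ∷ suf

IsEdgeRanking : ∀ {m} → Graph m → ℕ → (Fin m → Fin m → ℕ) → Set
IsEdgeRanking {m} T r φ =
  (∀ u v → E T u v → φ u v ≡ φ v u × 1 ≤ φ u v × φ u v ≤ r) ×
  -- distinct edges {a,b}, {c,d} with the same label: on the path of T
  -- that starts with the edge a–b and ends with the edge c–d there is an
  -- edge with a larger label
  (∀ a b c d → E T a b → E T c d →
     ¬ (a ≡ c × b ≡ d) → ¬ (a ≡ d × b ≡ c) → φ a b ≡ φ c d →
     ∀ p → Linked (E T) p → Unique p →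
       (∃ λ rest → p ≡ a ∷ b ∷ rest) →
       (∃ λ pre → p ≡ pre ++ c ∷ d ∷ []) →
       ∃ λ x → ∃ λ y → Consecutive x y p × φ a b < φ x y)

EdgeRankingNumber≡ : ∀ {m} → Graph m → ℕ → Set
EdgeRankingNumber≡ T r =
  (∃ λ φ → IsEdgeRanking T r φ) × (∀ r' φ → IsEdgeRanking T r' φ → r ≤ r')

-- Biclique covers: the t-th biclique is the complete bipartite subgraph
-- with parts A t, B t (every A t – B t pair is an edge of G).

IsBicliqueCover : ∀ {n} → Graph n → (k : ℕ) → (Fin k → Subset n) → (Fin k → Subset n) → Set
IsBicliqueCover G k A B =
  (∀ t x y → x ∈ A t → y ∈ B t → E G x y) ×
  (∀ u v → E G u v → ∃ λ t → (u ∈ A t × v ∈ B t) ⊎ (v ∈ A t × u ∈ B t))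

BicliqueCoverNumber≡ : ∀ {n} → Graph n → ℕ → Set
BicliqueCoverNumber≡ G k =
  (∃ λ A → ∃ λ B → IsBicliqueCover G k A B) ×
  (∀ k' A B → IsBicliqueCover G k' A B → k ≤ k')

{-# OPTIONS --safe #-}
-- A maximal clique of Gᶜ (a maximal independent set of G) is coded by the set of bicliques
-- A_t × B_t whose side A_t it meets. Two distinct maximal cliques K_i, K_j are joined by an
-- edge uv of G, and if uv lies in A_t × B_t then K_i meets A_t while K_j, containing v ∈ B_t
-- and being independent in G, cannot. Hence mc(Gᶜ) ≤ 2^bc(G).
--
-- Conversely, let φ be an edge ranking of the clique tree with labels 1, …, r and let π_t(K)
-- be the parity of the number of t-labelled edges on the tree path from a fixed root to K.
-- Put into A_t (resp. B_t) the vertices all of whose maximal cliques have π_t = 0 (resp. 1).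
-- Vertices sharing a clique are never split, so A_t × B_t ⊆ E(G). For an edge uv of G take a
-- tree path from a clique of u to a clique of v that meets the cliques of u and of v only at
-- its ends, and let M be its largest label. By the ranking property M occurs on the path only
-- once, so π_M differs at its ends. A vertex lies in at most two maximal cliques, which are
-- then adjacent in the tree by the clique-intersection property; the edge by which the second
-- clique of u (or of v) hangs off the path cannot carry M, as M would then repeat on a longer
-- path. So u and v are separated by π_M, and bc(G) ≤ χ'_r(T) = ⌈log₂ mc(Gᶜ)⌉.
module Submission where

open import Defs
open import Data.Nat.Logarithm using (⌈log₂⌉-mono-≤; ⌈log₂2^n⌉≡n)
open import Data.Bool using (Bool; true; false; not; _xor_)
import Data.Bool.Properties as Bool
open import Data.Empty using (⊥; ⊥-elim)
open import Data.Fin using (Fin; zero; suc; toℕ; fromℕ<; _≟_; funToFin; finToFun)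
open import Data.Fin.Properties using (all?; any?; toℕ-fromℕ<; injective⇒≤; finToFun-funToFin)
open import Data.Fin.Subset using (Subset; _∈_; _⊆_; _∪_; ⁅_⁆) renaming (⊥ to ∅)
open import Data.Vec using (tabulate)
open import Data.Vec.Properties using (lookup∘tabulate; lookup⇒[]=; []=⇒lookup)
open import Data.Fin.Subset.Properties
  using (_∈?_; x∈p∪q⁺; x∈p∪q⁻; p⊆p∪q; q⊆p∪q; ⊆-antisym; x∈⁅x⁆; x∈⁅y⁆⇒x≡y; x∈p∩q⁺)
open import Data.List using (List; []; _∷_; _++_; _∷ʳ_; _ʳ++_; head; last; length; foldl; allFin)
open import Data.List.Properties using (++-assoc; ++-ʳ++; length-ʳ++; ∷-injectiveˡ; ∷-injectiveʳ)
open import Data.List.Relation.Binary.Disjoint.Propositional using (Disjoint)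
open import Data.List.Membership.Propositional using () renaming (_∈_ to _∈ₗ_; _∉_ to _∉ₗ_)
open import Data.List.Membership.Propositional.Properties using (∈-++⁺ˡ; ∈-++⁺ʳ; ∈-++⁻; ∈-∃++; ∈-allFin)
open import Data.List.Relation.Unary.All as All using (All; []; _∷_)
import Data.List.Relation.Unary.All.Properties as All
open import Data.List.Relation.Unary.Any as Any using (Any; here; there)
import Data.List.Relation.Unary.First as First
import Data.List.Relation.Unary.First.Properties as First
open import Data.List.Relation.Unary.Linked as Linked using (Linked; []; [-]; _∷_)
open import Data.List.Relation.Unary.Unique.Propositional using (Unique; []; _∷_) renaming (tail to Unique-tail)
import Data.List.Relation.Unary.Unique.Propositional.Properties as Unique
open import Data.Maybe using (just)
open import Data.Maybe.Properties using (just-injective)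
import Data.Maybe.Relation.Binary.Connected as Maybe
open import Data.Nat as ℕ using (ℕ; zero; suc; _+_; _^_; _≤_; _<_; s≤s; z≤n)
open import Data.Nat.Properties using (≤-refl; ≤-trans; <⇒≤; <⇒≱; <⇒≢; ≤-<-connex; ≤-reflexive; m≤n+m)
open import Data.Product using (∃; ∃₂; _×_; _,_; proj₁; proj₂)
open import Data.Sum as Sum using (_⊎_; inj₁; inj₂; [_,_]′)
open import Function using (_∘_; flip)
open import Level using (0ℓ)
open import Relation.Nullary using (¬_; Dec; yes; no; does; contradiction)
open import Relation.Nullary.Decidable using (toSum; ¬?; _→-dec_; _×-dec_; decidable-stable; dec-true; dec-false)
open import Relation.Unary using (Pred; ∁; Decidable)
open import Relation.Binary.PropositionalEquality

module _ {A : Set} where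

  module _ {R : A → A → Set} where

    Linked-++⁻ˡ : ∀ xs {ys} → Linked R (xs ++ ys) → Linked R xs
    Linked-++⁻ˡ []           _        = []
    Linked-++⁻ˡ (x ∷ [])     _        = [-]
    Linked-++⁻ˡ (x ∷ y ∷ xs) (r ∷ rs) = r ∷ Linked-++⁻ˡ (y ∷ xs) rs

    Linked-++⁻ʳ : ∀ xs {ys} → Linked R (xs ++ ys) → Linked R ys
    Linked-++⁻ʳ []       rs = rs
    Linked-++⁻ʳ (x ∷ xs) rs = Linked-++⁻ʳ xs (Linked.tail rs)

    Linked-∷ʳ⁺ : ∀ xs {x y} → Linked R xs → last xs ≡ just x → R x y → Linked R (xs ∷ʳ y)
    Linked-∷ʳ⁺ (x ∷ [])     [-]      refl r = r ∷ [-]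
    Linked-∷ʳ⁺ (x ∷ y ∷ xs) (s ∷ rs) eq   r = s ∷ Linked-∷ʳ⁺ (y ∷ xs) rs eq r

    Linked-++-∷⁻ˡ : ∀ xs {x ys} → Linked R (xs ++ x ∷ ys) → Linked R (xs ∷ʳ x)
    Linked-++-∷⁻ˡ xs {x} {ys} rs = Linked-++⁻ˡ (xs ∷ʳ x) (subst (Linked R) (sym (++-assoc xs (x ∷ []) ys)) rs)

    Linked-infix : ∀ pre {x y suf} → Linked R (pre ++ x ∷ y ∷ suf) → R x y
    Linked-infix pre rs = Linked.head (Linked-++⁻ʳ pre rs)

    Linked-fromInfixes : ∀ xs → (∀ pre {x y} suf → xs ≡ pre ++ x ∷ y ∷ suf → R x y) → Linked R xs
    Linked-fromInfixes []           _ = []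
    Linked-fromInfixes (x ∷ [])     _ = [-]
    Linked-fromInfixes (x ∷ y ∷ xs) r =
      r [] xs refl ∷ Linked-fromInfixes (y ∷ xs) (λ pre suf eq → r (x ∷ pre) suf (cong (x ∷_) eq))

    Linked-∷ʳ⁻ : ∀ x xs {z} → Linked R (x ∷ xs ∷ʳ z) → ∃ λ w → last (x ∷ xs) ≡ just w × R w z
    Linked-∷ʳ⁻ x []       (r ∷ _)  = x , refl , r
    Linked-∷ʳ⁻ x (y ∷ xs) (_ ∷ rs) = Linked-∷ʳ⁻ y xs rs

    Linked-ʳ++⁺ : (∀ {x y} → R x y → R y x) →
                  ∀ {x} xs {acc} → Linked R (x ∷ xs) → Linked R (x ∷ acc) → Linked R (xs ʳ++ x ∷ acc)
    Linked-ʳ++⁺ R-sym []       _          r = r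
    Linked-ʳ++⁺ R-sym (y ∷ xs) (rxy ∷ rs) r = Linked-ʳ++⁺ R-sym xs rs (R-sym rxy ∷ r)

  Unique-++⁻ˡ : ∀ xs {ys : List A} → Unique (xs ++ ys) → Unique xs
  Unique-++⁻ˡ []       _        = []
  Unique-++⁻ˡ (x ∷ xs) (px ∷ u) = All.++⁻ˡ xs px ∷ Unique-++⁻ˡ xs u

  Unique-++⁻ʳ : ∀ xs {ys : List A} → Unique (xs ++ ys) → Unique ys
  Unique-++⁻ʳ []       u       = u
  Unique-++⁻ʳ (x ∷ xs) (_ ∷ u) = Unique-++⁻ʳ xs u

  Unique-++-∷⁻ˡ : ∀ xs {x : A} {ys} → Unique (xs ++ x ∷ ys) → Unique (xs ∷ʳ x)
  Unique-++-∷⁻ˡ xs {x} {ys} u = Unique-++⁻ˡ (xs ∷ʳ x) (subst Unique (sym (++-assoc xs (x ∷ []) ys)) u)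

  Unique-++-∷⇒∉ˡ : ∀ xs {x : A} {ys} → Unique (xs ++ x ∷ ys) → x ∉ₗ xs
  Unique-++-∷⇒∉ˡ (y ∷ xs) (y∉ ∷ u) (here x≡y)   = All.lookup (All.++⁻ʳ xs y∉) (here refl) (sym x≡y)
  Unique-++-∷⇒∉ˡ (y ∷ xs) (_ ∷ u)  (there x∈xs) = Unique-++-∷⇒∉ˡ xs u x∈xs

  Unique-∷ʳ⁺ : ∀ {xs} {x : A} → Unique xs → x ∉ₗ xs → Unique (xs ∷ʳ x)
  Unique-∷ʳ⁺ u x∉xs = Unique.++⁺ u ([] ∷ []) λ { (x∈xs , here refl) → x∉xs x∈xs }

  Unique-ʳ++⁺ : ∀ xs {acc : List A} → Unique xs → Unique acc → Disjoint xs acc → Unique (xs ʳ++ acc)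
  Unique-ʳ++⁺ []       _            u disjoint = u
  Unique-ʳ++⁺ (x ∷ xs) (x∉xs ∷ uxs) u disjoint =
    Unique-ʳ++⁺ xs uxs (All.tabulate (λ v∈acc x≡v → disjoint (here (sym x≡v) , v∈acc)) ∷ u) λ where
      (v∈xs , here v≡x)     → All.lookup x∉xs v∈xs (sym v≡x)
      (v∈xs , there v∈acc) → disjoint (there v∈xs , v∈acc)

  last-∷ʳ : ∀ (xs : List A) x → last (xs ∷ʳ x) ≡ just x
  last-∷ʳ []           x = refl
  last-∷ʳ (y ∷ [])     x = refl
  last-∷ʳ (y ∷ z ∷ xs) x = last-∷ʳ (z ∷ xs) x

  last-++-∷ : ∀ (xs : List A) y ys → last (xs ++ y ∷ ys) ≡ last (y ∷ ys)
  last-++-∷ []           y ys = refl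
  last-++-∷ (x ∷ [])     y ys = refl
  last-++-∷ (x ∷ z ∷ xs) y ys = last-++-∷ (z ∷ xs) y ys

  last-ʳ++ : ∀ xs {x : A} acc → last (xs ʳ++ x ∷ acc) ≡ last (x ∷ acc)
  last-ʳ++ []       acc = refl
  last-ʳ++ (y ∷ xs) acc = last-ʳ++ xs (_ ∷ acc)

  last-∈ : ∀ xs {x : A} → last xs ≡ just x → x ∈ₗ xs
  last-∈ (x ∷ [])     refl = here refl
  last-∈ (x ∷ y ∷ xs) eq   = there (last-∈ (y ∷ xs) eq)

  last-∷-defined : ∀ (x : A) xs → ∃ λ y → last (x ∷ xs) ≡ just y
  last-∷-defined x []       = x , refl
  last-∷-defined x (y ∷ xs) = last-∷-defined y xs

  head-++-∷ : ∀ (xs : List A) y ys zs → head (xs ++ y ∷ ys) ≡ head (xs ++ y ∷ zs)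
  head-++-∷ []       y ys zs = refl
  head-++-∷ (x ∷ xs) y ys zs = refl

  head-∷ʳ : ∀ xs {x y : A} → head xs ≡ just x → head (xs ∷ʳ y) ≡ just x
  head-∷ʳ (x ∷ xs) refl = refl

  head≡just⇒∷ : ∀ xs {x : A} → head xs ≡ just x → ∃ λ ys → xs ≡ x ∷ ys
  head≡just⇒∷ (x ∷ xs) refl = xs , refl

  module _ {Q : Pred A 0ℓ} (Q? : Decidable Q) where

    firstView : ∀ {xs} → Any Q xs → ∃ λ pre → ∃ λ x → ∃ λ suf →
                xs ≡ pre ++ x ∷ suf × Q x × All (∁ Q) pre
    firstView {xs} q∈xs with First.first (Sum.swap ∘ toSum ∘ Q?) xs
    ... | inj₂ none    = contradiction q∈xs (All.All¬⇒¬Any none)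
    ... | inj₁ q-first with First.toView q-first
    ...   | none First.++ qx ∷ suf = _ , _ , suf , refl , qx , none

    lastView : ∀ {xs} → Any Q xs → ∃ λ pre → ∃ λ x → ∃ λ suf →
               xs ≡ pre ++ x ∷ suf × Q x × All (∁ Q) suf
    lastView {x ∷ xs} q∈x∷xs with Any.any? Q? xs
    ... | yes q∈xs with lastView q∈xs
    ...   | pre , y , suf , refl , qy , none = x ∷ pre , y , suf , refl , qy , none
    lastView {x ∷ xs} (here qx)  | no q∉xs = [] , x , xs , refl , qx , All.¬Any⇒All¬ xs q∉xs
    lastView {x ∷ xs} (there q∈xs) | no q∉xs = contradiction q∈xs q∉xs

-- Graphs, complements and maximal cliques

module _ {n} (G : Graph n) where

  E-sym : ∀ {x y} → E G x y → E G y x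
  E-sym {x} {y} e = trans (adj-sym G y x) e

  E-irrefl : ∀ {x y} → E G x y → x ≢ y
  E-irrefl {x} e refl = contradiction (trans (sym (adj-irrefl G x)) e) λ ()

  complement-E⁺ : ∀ {x y} → x ≢ y → adj G x y ≡ false → E (complement G) x y
  complement-E⁺ {x} {y} x≢y xy-false with adj G x y | x ≟ y
  ... | false | no _    = refl
  ... | false | yes x≡y = contradiction x≡y x≢y
  complement-E⁺ _ () | true | _

  complement-E⁻ : ∀ {x y} → E (complement G) x y → adj G x y ≡ false
  complement-E⁻ {x} {y} e with adj G x y
  ... | false = refl
  complement-E⁻ () | true

  ¬complement-E⇒E : ∀ {x y} → x ≢ y → ¬ E (complement G) x y → E G x y
  ¬complement-E⇒E {x} {y} x≢y ¬e =
    decidable-stable (adj G x y Bool.≟ true) λ ¬E → ¬e (complement-E⁺ x≢y (Bool.¬-not ¬E))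

  maxClique-complement⇒maxIndependent : ∀ {S} → IsMaxClique (complement G) S → IsMaxIndependent G S
  maxClique-complement⇒maxIndependent (clique , maximal) =
    (λ x y x∈S y∈S x≢y → complement-E⁻ (clique x y x∈S y∈S x≢y)) ,
    (λ S′ independent S⊆S′ →
       maximal S′ (λ x y x∈S′ y∈S′ x≢y → complement-E⁺ x≢y (independent x y x∈S′ y∈S′ x≢y)) S⊆S′)

  clique-complement⇒¬E : ∀ {S x y} → IsClique (complement G) S → x ∈ S → y ∈ S → ¬ E G x y
  clique-complement⇒¬E {x = x} {y} clique x∈S y∈S e with x ≟ y
  ... | yes refl = E-irrefl e refl
  ... | no x≢y   = contradiction (trans (sym (complement-E⁻ (clique x y x∈S y∈S x≢y))) e) λ ()

module _ {n} {P : Fin n → Set} (P? : Decidable P) where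

  subsetOf : Subset n
  subsetOf = tabulate (does ∘ P?)

  ∈-subsetOf⁺ : ∀ {x} → P x → x ∈ subsetOf
  ∈-subsetOf⁺ {x} px = lookup⇒[]= x subsetOf (trans (lookup∘tabulate (does ∘ P?) x) (dec-true (P? x) px))

  ∈-subsetOf⁻ : ∀ {x} → x ∈ subsetOf → P x
  ∈-subsetOf⁻ {x} x∈ with P? x | trans (sym (lookup∘tabulate (does ∘ P?) x)) ([]=⇒lookup x∈)
  ... | yes px | _  = px
  ... | no  _  | ()

module MaximalCliques {n} (H : Graph n) where

  ⁅⁆-clique : ∀ x → IsClique H ⁅ x ⁆
  ⁅⁆-clique x i j i∈ j∈ i≢j = contradiction (trans (x∈⁅y⁆⇒x≡y x i∈) (sym (x∈⁅y⁆⇒x≡y x j∈))) i≢j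

  ∪-clique : ∀ {S S′} → IsClique H S → IsClique H S′ →
             (∀ x y → x ∈ S → y ∈ S′ → x ≢ y → E H x y) → IsClique H (S ∪ S′)
  ∪-clique {S} {S′} clique clique′ across x y x∈ y∈ x≢y with x∈p∪q⁻ S S′ x∈ | x∈p∪q⁻ S S′ y∈
  ... | inj₁ x∈S  | inj₁ y∈S  = clique x y x∈S y∈S x≢y
  ... | inj₂ x∈S′ | inj₂ y∈S′ = clique′ x y x∈S′ y∈S′ x≢y
  ... | inj₁ x∈S  | inj₂ y∈S′ = across x y x∈S y∈S′ x≢y
  ... | inj₂ x∈S′ | inj₁ y∈S  = E-sym H (across y x y∈S x∈S′ (x≢y ∘ sym))

  Extends : Subset n → Fin n → Set
  Extends S v = ∀ w → w ∈ S → w ≢ v → E H v w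

  extends? : ∀ S v → Dec (Extends S v)
  extends? S v = all? λ w → w ∈? S →-dec ¬? (w ≟ v) →-dec adj H v w Bool.≟ true

  grow : Subset n → Fin n → Subset n
  grow S v with extends? S v
  ... | yes _ = S ∪ ⁅ v ⁆
  ... | no  _ = S

  grow-clique : ∀ {S} v → IsClique H S → IsClique H (grow S v)
  grow-clique {S} v clique with extends? S v
  ... | no  _       = clique
  ... | yes extends = ∪-clique clique (⁅⁆-clique v) λ x y x∈S y∈⁅v⁆ x≢y →
    E-sym H (subst (λ z → E H z x) (sym (x∈⁅y⁆⇒x≡y v y∈⁅v⁆))
                   (extends x x∈S (λ x≡v → x≢y (trans x≡v (sym (x∈⁅y⁆⇒x≡y v y∈⁅v⁆))))))

  grow-⊇ : ∀ S v → S ⊆ grow S v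
  grow-⊇ S v with extends? S v
  ... | yes _ = p⊆p∪q ⁅ v ⁆
  ... | no  _ = λ x∈S → x∈S

  grow-saturated : ∀ S v → v ∈ grow S v ⊎ ¬ Extends S v
  grow-saturated S v with extends? S v
  ... | yes _        = inj₁ (x∈p∪q⁺ (inj₂ (x∈⁅x⁆ v)))
  ... | no  ¬extends = inj₂ ¬extends

  foldl-grow-clique : ∀ {S} vs → IsClique H S → IsClique H (foldl grow S vs)
  foldl-grow-clique []       clique = clique
  foldl-grow-clique (v ∷ vs) clique = foldl-grow-clique vs (grow-clique v clique)

  foldl-grow-⊇ : ∀ S vs → S ⊆ foldl grow S vs
  foldl-grow-⊇ S []       x∈S = x∈S
  foldl-grow-⊇ S (v ∷ vs) x∈S = foldl-grow-⊇ (grow S v) vs (grow-⊇ S v x∈S)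

  foldl-grow-saturated : ∀ S vs {v} → v ∈ₗ vs → v ∈ foldl grow S vs ⊎ ¬ Extends (foldl grow S vs) v
  foldl-grow-saturated S (v ∷ vs) (here refl) with grow-saturated S v
  ... | inj₁ v∈       = inj₁ (foldl-grow-⊇ (grow S v) vs v∈)
  ... | inj₂ ¬extends =
    inj₂ λ extends → ¬extends λ w w∈S → extends w (foldl-grow-⊇ (grow S v) vs (grow-⊇ S v w∈S))
  foldl-grow-saturated S (u ∷ vs) (there v∈vs) = foldl-grow-saturated (grow S u) vs v∈vs

  clique⊆maxClique : ∀ {S} → IsClique H S → ∃ λ S′ → IsMaxClique H S′ × S ⊆ S′
  clique⊆maxClique {S} clique = F , (foldl-grow-clique (allFin n) clique , maximal) , foldl-grow-⊇ S (allFin n)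
    where
      F = foldl grow S (allFin n)
      maximal : ∀ S′ → IsClique H S′ → F ⊆ S′ → S′ ⊆ F
      maximal S′ clique′ F⊆S′ {v} v∈S′ with foldl-grow-saturated S (allFin n) (∈-allFin v)
      ... | inj₁ v∈F      = v∈F
      ... | inj₂ ¬extends = contradiction (λ w w∈F w≢v → clique′ v w v∈S′ (F⊆S′ w∈F) (w≢v ∘ sym)) ¬extends

  maxClique-∋ : ∀ x → ∃ λ S → IsMaxClique H S × x ∈ S
  maxClique-∋ x with clique⊆maxClique (⁅⁆-clique x)
  ... | S , maxClique , ⁅x⁆⊆S = S , maxClique , ⁅x⁆⊆S (x∈⁅x⁆ x)

  maxClique-∋-edge : ∀ {x y} → E H x y → ∃ λ S → IsMaxClique H S × x ∈ S × y ∈ S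
  maxClique-∋-edge {x} {y} e with clique⊆maxClique pair-clique
    where
      pair-clique : IsClique H (⁅ x ⁆ ∪ ⁅ y ⁆)
      pair-clique = ∪-clique (⁅⁆-clique x) (⁅⁆-clique y) λ x′ y′ x′∈ y′∈ _ →
        subst₂ (E H) (sym (x∈⁅y⁆⇒x≡y x x′∈)) (sym (x∈⁅y⁆⇒x≡y y y′∈)) e
  ... | S , maxClique , pair⊆S =
    S , maxClique , pair⊆S (x∈p∪q⁺ (inj₁ (x∈⁅x⁆ x))) , pair⊆S (x∈p∪q⁺ (inj₂ (x∈⁅x⁆ y)))

  maxCliques-≢⇒nonEdge : ∀ {S S′} → IsMaxClique H S → IsMaxClique H S′ → S ≢ S′ →
                         ∃₂ λ u v → u ∈ S × v ∈ S′ × u ≢ v × ¬ E H u v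
  maxCliques-≢⇒nonEdge {S} {S′} (clique , maximal) (clique′ , maximal′) S≢S′
    with any? (λ u → any? λ v → u ∈? S ×-dec v ∈? S′ ×-dec ¬? (u ≟ v) ×-dec ¬? (adj H u v Bool.≟ true))
  ... | yes (u , v , witness) = u , v , witness
  ... | no ¬witness = contradiction (⊆-antisym S⊆S′ S′⊆S) S≢S′
    where
      across : ∀ x y → x ∈ S → y ∈ S′ → x ≢ y → E H x y
      across x y x∈S y∈S′ x≢y =
        decidable-stable (adj H x y Bool.≟ true) λ ¬e → ¬witness (x , y , x∈S , y∈S′ , x≢y , ¬e)
      union-clique : IsClique H (S ∪ S′)
      union-clique = ∪-clique clique clique′ across
      S⊆S′ : S ⊆ S′
      S⊆S′ x∈S = maximal′ (S ∪ S′) union-clique (q⊆p∪q S S′) (p⊆p∪q S′ x∈S)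
      S′⊆S : S′ ⊆ S
      S′⊆S x∈S′ = maximal (S ∪ S′) union-clique (p⊆p∪q S′) (q⊆p∪q S S′ x∈S′)

-- Paths

module _ {m} (T : Graph m) where

  edge-path : ∀ {u v} → E T u v → PathBetween T u v (u ∷ v ∷ [])
  edge-path e = (e ∷ [-]) , ((E-irrefl T e ∷ []) ∷ [] ∷ []) , refl , refl

  path-∷ʳ : ∀ {u v w p} → PathBetween T u v p → E T v w → w ∉ₗ p → PathBetween T u w (p ∷ʳ w)
  path-∷ʳ {p = p} (lp , up , hp , tp) e w∉p =
    Linked-∷ʳ⁺ p lp tp e , Unique-∷ʳ⁺ up w∉p , head-∷ʳ p hp , last-∷ʳ p _

  path-prefix : ∀ {u v w} pre {suf} → PathBetween T u v (pre ++ w ∷ suf) → PathBetween T u w (pre ∷ʳ w)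
  path-prefix {w = w} pre {suf} (lp , up , hp , _) =
    Linked-++-∷⁻ˡ pre lp , Unique-++-∷⁻ˡ pre up , trans (head-++-∷ pre w [] suf) hp , last-∷ʳ pre w

  path-suffix : ∀ {u v w} pre {suf} → PathBetween T u v (pre ++ w ∷ suf) → PathBetween T w v (w ∷ suf)
  path-suffix {w = w} pre {suf} (lp , up , _ , tp) =
    Linked-++⁻ʳ pre lp , Unique-++⁻ʳ pre up , refl , trans (sym (last-++-∷ pre w suf)) tp

record Bridge {m} (T : Graph m) (U V : Fin m → Set) : Set where
  field
    start end : Fin m
    via       : List (Fin m)
    path      : PathBetween T start end (start ∷ via ∷ʳ end)
    start∈U   : U start
    end∈V     : V end
    start∉V   : ¬ V start
    end∉U     : ¬ U end
    via∉U     : All (∁ U) via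
    via∉V     : All (∁ V) via

  U-only-at-start : ∀ {l} → l ∈ₗ start ∷ via ∷ʳ end → U l → l ≡ start
  U-only-at-start (here refl) _ = refl
  U-only-at-start (there l∈) l∈U with ∈-++⁻ via l∈
  ... | inj₁ l∈via      = contradiction l∈U (All.lookup via∉U l∈via)
  ... | inj₂ (here refl) = contradiction l∈U end∉U

  V-only-at-end : ∀ {l} → l ∈ₗ start ∷ via ∷ʳ end → V l → l ≡ end
  V-only-at-end (here refl) l∈V = contradiction l∈V start∉V
  V-only-at-end (there l∈) l∈V with ∈-++⁻ via l∈
  ... | inj₁ l∈via      = contradiction l∈V (All.lookup via∉V l∈via)
  ... | inj₂ (here refl) = refl

bridge : ∀ {m} {T : Graph m} {U V : Fin m → Set} → Connected T → Decidable U → Decidable V →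
         (∀ k → U k → ¬ V k) → ∀ {i j} → U i → V j → Bridge T U V
bridge {T = T} {U} {V} connected U? V? disjoint {i} {j} i∈U j∈V with connected i j
... | p , path-p@(_ , _ , head≡ , _)
    with lastView U? (subst (Any U) (sym (proj₂ (head≡just⇒∷ p head≡))) (here i∈U))
... | s₁ , i₀ , s₂ , p≡ , i₀∈U , s₂∉U
    with firstView V? (Any.map (λ j≡l → subst V j≡l j∈V) (last-∈ (i₀ ∷ s₂) last≡j))
  where
    last≡j : last (i₀ ∷ s₂) ≡ just j
    last≡j = proj₂ (proj₂ (proj₂ (path-suffix T s₁ (subst (PathBetween T i j) p≡ path-p))))
... | []       , _  , _  , refl , i₀∈V , _ = contradiction i₀∈V (disjoint i₀ i₀∈U)
... | _ ∷ via , j₀ , t₂ , refl , j₀∈V , i₀∉V ∷ via∉V = record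
  { start = i₀ ; end = j₀ ; via = via
  ; path    = path-prefix T (i₀ ∷ via) (path-suffix T s₁ (subst (PathBetween T i j) p≡ path-p))
  ; start∈U = i₀∈U ; end∈V = j₀∈V ; start∉V = i₀∉V ; end∉U = All.head (All.++⁻ʳ via s₂∉U)
  ; via∉U   = All.++⁻ˡ via s₂∉U ; via∉V = via∉V }

module AcyclicPaths {m} (T : Graph m) (acyclic : Acyclic T) where

  private
    cycle-length : ∀ (P Q : List (Fin m)) → ¬ (P ≡ [] × Q ≡ []) → 3 ≤ suc (length P + suc (length Q))
    cycle-length []      []      nontrivial = contradiction (refl , refl) nontrivial
    cycle-length []      (_ ∷ _) _          = s≤s (s≤s (s≤s z≤n))
    cycle-length (_ ∷ P) Q       _          = s≤s (s≤s (≤-trans (s≤s z≤n) (m≤n+m (suc (length Q)) (length P))))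

  ¬closed-branches : ∀ {a z} P Q → Linked (E T) (a ∷ P ∷ʳ z) → Linked (E T) (a ∷ Q ∷ʳ z) →
                     Unique (P ∷ʳ z) → Unique (a ∷ Q) → Disjoint (P ∷ʳ z) (a ∷ Q) →
                     ¬ (P ≡ [] × Q ≡ []) → ⊥
  ¬closed-branches {a} {z} P Q linkedP linkedQ uniqueP uniqueQ disjoint nontrivial with Linked-∷ʳ⁻ a Q linkedQ
  ... | w , last≡w , wz = acyclic cycle
    ( subst (3 ≤_) (sym cycle-length≡) (cycle-length P Q nontrivial)
    , Linked-ʳ++⁺ (E-sym T) (P ∷ʳ z) linkedP (Linked-++⁻ˡ (a ∷ Q) linkedQ)
    , Unique-ʳ++⁺ (P ∷ʳ z) uniqueP uniqueQ disjoint
    , z , w , cong head (++-ʳ++ P) , trans (last-ʳ++ (P ∷ʳ z) Q) last≡w , wz )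
    where
      cycle = (P ∷ʳ z) ʳ++ a ∷ Q
      cycle-length≡ : length cycle ≡ suc (length P + suc (length Q))
      cycle-length≡ = trans (cong length (++-ʳ++ P)) (cong suc (length-ʳ++ P))

  ¬forked-paths : ∀ {a x y P Q} → Linked (E T) (a ∷ x ∷ P) → Unique (a ∷ x ∷ P) →
                  Linked (E T) (a ∷ y ∷ Q) → Unique (a ∷ y ∷ Q) →
                  last (x ∷ P) ≡ last (y ∷ Q) → x ≢ y → ⊥
  ¬forked-paths {a} {x} {y} {P} {Q} linkedP (a∉xP ∷ uniqueP) linkedQ (a∉yQ ∷ uniqueQ) same-end x≢y
    with firstView (λ v → Any.any? (v ≟_) (y ∷ Q)) ends-meet
    where
      ends-meet : Any (_∈ₗ y ∷ Q) (x ∷ P)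
      ends-meet with last-∷-defined x P
      ... | b , last≡b = Any.map (λ b≡v → subst (_∈ₗ y ∷ Q) b≡v (last-∈ (y ∷ Q) (trans (sym same-end) last≡b)))
                                 (last-∈ (x ∷ P) last≡b)
  ... | P₁ , z , P₂ , xP≡ , z∈yQ , P₁∉yQ with ∈-∃++ z∈yQ
  ... | Q₁ , Q₂ , yQ≡ = ¬closed-branches P₁ Q₁
    (Linked-++-∷⁻ˡ (a ∷ P₁) (subst (λ l → Linked (E T) (a ∷ l)) xP≡ linkedP))
    (Linked-++-∷⁻ˡ (a ∷ Q₁) (subst (λ l → Linked (E T) (a ∷ l)) yQ≡ linkedQ))
    (Unique-++-∷⁻ˡ P₁ (subst Unique xP≡ uniqueP))
    (Unique-++⁻ˡ (a ∷ Q₁) (subst (λ l → Unique (a ∷ l)) yQ≡ (a∉yQ ∷ uniqueQ)))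
    disjoint
    λ { (refl , refl) → x≢y (trans (∷-injectiveˡ xP≡) (sym (∷-injectiveˡ yQ≡))) }
    where
      a∉P₁zP₂ : a ∉ₗ P₁ ++ z ∷ P₂
      a∉P₁zP₂ a∈ = All.lookup a∉xP (subst (a ∈ₗ_) (sym xP≡) a∈) refl
      disjoint : Disjoint (P₁ ∷ʳ z) (a ∷ Q₁)
      disjoint (v∈ , v∈aQ₁) with ∈-++⁻ P₁ v∈ | v∈aQ₁
      ... | inj₁ v∈P₁        | here refl   = a∉P₁zP₂ (∈-++⁺ˡ v∈P₁)
      ... | inj₂ (here refl) | here refl   = a∉P₁zP₂ (∈-++⁺ʳ P₁ (here refl))
      ... | inj₁ v∈P₁        | there v∈Q₁ = All.lookup P₁∉yQ v∈P₁ (subst (_ ∈ₗ_) (sym yQ≡) (∈-++⁺ˡ v∈Q₁))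
      ... | inj₂ (here refl) | there v∈Q₁ = Unique-++-∷⇒∉ˡ Q₁ (subst Unique yQ≡ uniqueQ) v∈Q₁

  ∷-paths-unique : ∀ a p q → Linked (E T) (a ∷ p) → Unique (a ∷ p) → Linked (E T) (a ∷ q) → Unique (a ∷ q) →
                   last (a ∷ p) ≡ last (a ∷ q) → p ≡ q
  ∷-paths-unique a []      []      _ _ _ _ _ = refl
  ∷-paths-unique a []      (y ∷ q) _ _ _ uq same-end =
    contradiction (last-∈ (y ∷ q) (sym same-end)) (Unique.Unique[x∷xs]⇒x∉xs uq)
  ∷-paths-unique a (x ∷ p) []      _ up _ _ same-end =
    contradiction (last-∈ (x ∷ p) same-end) (Unique.Unique[x∷xs]⇒x∉xs up)
  ∷-paths-unique a (x ∷ p) (y ∷ q) lp up lq uq same-end with x ≟ y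
  ... | yes refl =
    cong (x ∷_) (∷-paths-unique x p q (Linked.tail lp) (Unique-tail up) (Linked.tail lq) (Unique-tail uq) same-end)
  ... | no x≢y  = ⊥-elim (¬forked-paths lp up lq uq same-end x≢y)

  path-unique : ∀ {u v p q} → PathBetween T u v p → PathBetween T u v q → p ≡ q
  path-unique {p = p} {q} (lp , up , hp , tp) (lq , uq , hq , tq) with head≡just⇒∷ p hp | head≡just⇒∷ q hq
  ... | p′ , refl | q′ , refl = cong (_ ∷_) (∷-paths-unique _ p′ q′ lp up lq uq (trans tp (sym tq)))

  path-edge-extension : ∀ {ρ i k p q} → E T i k → PathBetween T ρ i p → PathBetween T ρ k q →
                        q ≡ p ∷ʳ k ⊎ p ≡ q ∷ʳ i
  path-edge-extension {i = i} {k} {p} {q} e path-p path-q with Any.any? (k ≟_) p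
  ... | no k∉p = inj₁ (path-unique path-q (path-∷ʳ T path-p e k∉p))
  ... | yes k∈p with ∈-∃++ k∈p
  ... | p₁ , p₂ , refl = inj₂ (begin
    p₁ ++ k ∷ p₂     ≡⟨ cong (λ s → p₁ ++ k ∷ s) p₂≡[i] ⟩
    p₁ ++ k ∷ i ∷ [] ≡⟨ ++-assoc p₁ (k ∷ []) (i ∷ []) ⟨
    p₁ ∷ʳ k ∷ʳ i     ≡⟨ cong (_∷ʳ i) q≡p₁k ⟨
    q ∷ʳ i           ∎)
    where
      open ≡-Reasoning
      q≡p₁k : q ≡ p₁ ∷ʳ k
      q≡p₁k = path-unique path-q (path-prefix T p₁ path-p)
      p₂≡[i] : p₂ ≡ i ∷ []
      p₂≡[i] = ∷-injectiveʳ (path-unique (path-suffix T p₁ path-p) (edge-path T (E-sym T e)))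

-- Edge labels: parities and rankings

xor-cancelʳ : ∀ a b → (a xor b) xor b ≡ a
xor-cancelʳ a b = begin
  (a xor b) xor b ≡⟨ Bool.xor-assoc a b b ⟩
  a xor (b xor b) ≡⟨ cong (a xor_) (Bool.xor-same b) ⟩
  a xor false     ≡⟨ Bool.xor-identityʳ a ⟩
  a               ∎
  where open ≡-Reasoning

module Labelling {m} (φ : Fin m → Fin m → ℕ) where

  labelled : ℕ → Fin m → Fin m → Bool
  labelled t x y = does (φ x y ℕ.≟ t)

  parity : ℕ → List (Fin m) → Bool
  parity t (x ∷ y ∷ xs) = labelled t x y xor parity t (y ∷ xs)
  parity t _            = false

  parity-∷ʳ : ∀ t xs {i k} → last xs ≡ just i → parity t (xs ∷ʳ k) ≡ parity t xs xor labelled t i k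
  parity-∷ʳ t (x ∷ [])     refl = Bool.xor-identityʳ _
  parity-∷ʳ t (x ∷ y ∷ xs) eq   =
    trans (cong (labelled t x y xor_) (parity-∷ʳ t (y ∷ xs) eq))
          (sym (Bool.xor-assoc (labelled t x y) (parity t (y ∷ xs)) _))

  parity-++-∷ : ∀ t xs y ys → parity t (xs ++ y ∷ ys) ≡ parity t (xs ∷ʳ y) xor parity t (y ∷ ys)
  parity-++-∷ t []           y ys = refl
  parity-++-∷ t (x ∷ [])     y ys = cong (_xor parity t (y ∷ ys)) (sym (Bool.xor-identityʳ (labelled t x y)))
  parity-++-∷ t (x ∷ z ∷ xs) y ys =
    trans (cong (labelled t x z xor_) (parity-++-∷ t (z ∷ xs) y ys))
          (sym (Bool.xor-assoc (labelled t x z) (parity t (z ∷ xs ∷ʳ y)) (parity t (y ∷ ys))))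

  parity-unlabelled : ∀ t {xs} → Linked (λ x y → φ x y ≢ t) xs → parity t xs ≡ false
  parity-unlabelled t []        = refl
  parity-unlabelled t [-]       = refl
  parity-unlabelled t (≢t ∷ rs) = cong₂ _xor_ (dec-false (_ ℕ.≟ t) ≢t) (parity-unlabelled t rs)

  record MaxLabelSplit (p : List (Fin m)) : Set where
    field
      pre suf      : List (Fin m)
      c d          : Fin m
      split        : p ≡ pre ++ c ∷ d ∷ suf
      bounded      : Linked (λ x y → φ x y ≤ φ c d) p
      below-before : Linked (λ x y → φ x y < φ c d) (pre ∷ʳ c)

  max-label-split : ∀ x xs z → MaxLabelSplit (x ∷ xs ∷ʳ z)
  max-label-split x []       z = record
    { pre = [] ; suf = [] ; c = x ; d = z ; split = refl ; bounded = ≤-refl ∷ [-] ; below-before = [-] }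
  max-label-split x (y ∷ xs) z = extend (max-label-split y xs z)
    where
      extend : MaxLabelSplit (y ∷ xs ∷ʳ z) → MaxLabelSplit (x ∷ y ∷ xs ∷ʳ z)
      extend σ = [ first-edge-max , later-edge-max ]′ (≤-<-connex (φ c d) (φ x y))
        where
          open MaxLabelSplit σ
          first-edge-max : φ c d ≤ φ x y → MaxLabelSplit (x ∷ y ∷ xs ∷ʳ z)
          first-edge-max cd≤xy = record
            { pre = [] ; suf = xs ∷ʳ z ; c = x ; d = y ; split = refl
            ; bounded = ≤-refl ∷ Linked.map (λ ≤cd → ≤-trans ≤cd cd≤xy) bounded ; below-before = [-] }
          later-edge-max : φ x y < φ c d → MaxLabelSplit (x ∷ y ∷ xs ∷ʳ z)
          later-edge-max xy<cd = record
            { pre = x ∷ pre ; suf = suf ; c = c ; d = d ; split = cong (x ∷_) split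
            ; bounded = <⇒≤ xy<cd ∷ bounded
            ; below-before =
                subst (Maybe.Connected _ (just x)) (sym starts-with-y) (Maybe.just xy<cd) Linked.∷′ below-before }
            where
              starts-with-y : head (pre ∷ʳ c) ≡ just y
              starts-with-y = trans (head-++-∷ pre c [] (d ∷ suf)) (cong head (sym split))

module TreeParity {m} (T : Graph m) (tree : IsTree T) (φ : Fin m → Fin m → ℕ)
                  (φ-sym : ∀ {u v} → E T u v → φ u v ≡ φ v u) (ρ : Fin m) where

  open Labelling φ
  open AcyclicPaths T (proj₂ tree)

  π : ℕ → Fin m → Bool
  π t u = parity t (proj₁ (proj₁ tree ρ u))

  π-edge : ∀ t {i k} → E T i k → π t k ≡ π t i xor labelled t i k
  π-edge t {i} {k} e with proj₁ tree ρ i | proj₁ tree ρ k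
  ... | p , path-p | q , path-q with path-edge-extension e path-p path-q
  ... | inj₁ refl = parity-∷ʳ t p (proj₂ (proj₂ (proj₂ path-p)))
  ... | inj₂ refl = begin
    parity t q                                         ≡⟨ xor-cancelʳ (parity t q) (labelled t k i) ⟨
    (parity t q xor labelled t k i) xor labelled t k i
      ≡⟨ cong₂ _xor_ (parity-∷ʳ t q (proj₂ (proj₂ (proj₂ path-q)))) ki≡ik ⟨
    parity t (q ∷ʳ i) xor labelled t i k               ∎
    where
      open ≡-Reasoning
      ki≡ik : labelled t i k ≡ labelled t k i
      ki≡ik = cong (λ l → does (l ℕ.≟ t)) (φ-sym e)

  π-unlabelled-edge : ∀ {t i k} → E T i k → φ i k ≢ t → π t k ≡ π t i
  π-unlabelled-edge {t} {i} e ≢t =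
    trans (π-edge t e) (trans (cong (π t i xor_) (dec-false (_ ℕ.≟ t) ≢t)) (Bool.xor-identityʳ (π t i)))

  π-walk : ∀ t {x y} xs → Linked (E T) (x ∷ xs) → last (x ∷ xs) ≡ just y → π t y ≡ π t x xor parity t (x ∷ xs)
  π-walk t []       _        refl = sym (Bool.xor-identityʳ _)
  π-walk t {x} {y} (z ∷ xs) (e ∷ rs) last≡y = begin
    π t y                                            ≡⟨ π-walk t xs rs last≡y ⟩
    π t z xor parity t (z ∷ xs)                      ≡⟨ cong (_xor parity t (z ∷ xs)) (π-edge t e) ⟩
    (π t x xor labelled t x z) xor parity t (z ∷ xs) ≡⟨ Bool.xor-assoc (π t x) (labelled t x z) _ ⟩
    π t x xor parity t (x ∷ z ∷ xs)                  ∎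
    where open ≡-Reasoning

module EdgeRanking {m} (T : Graph m) {r} {φ : Fin m → Fin m → ℕ} (ranking : IsEdgeRanking T r φ) where

  Edge≤ : ℕ → Fin m → Fin m → Set
  Edge≤ M x y = E T x y × φ x y ≤ M

  first-max-label-unique : ∀ {a b} rest → Linked (Edge≤ (φ a b)) (a ∷ b ∷ rest) → Unique (a ∷ b ∷ rest) →
                           Linked (λ x y → φ x y ≢ φ a b) (b ∷ rest)
  first-max-label-unique {a} {b} rest bounded unique = Linked-fromInfixes (b ∷ rest) label≢
    where
      label≢ : ∀ pre {x y} suf → b ∷ rest ≡ pre ++ x ∷ y ∷ suf → φ x y ≢ φ a b
      label≢ pre {x} {y} suf eq xy≡ab = no-larger-label (proj₂ ranking a b x y
        (proj₁ (Linked.head bounded)) (proj₁ (Linked-infix (a ∷ pre) bounded-p))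
        (λ (a≡x , _) → a∉ (subst (_∈ₗ b ∷ rest) (sym a≡x) x∈))
        (λ (a≡y , _) → a∉ (subst (_∈ₗ b ∷ rest) (sym a≡y) y∈))
        (sym xy≡ab) p (Linked.map proj₁ bounded-p) unique-p
        (proj₁ starts-with-ab , cong (a ∷_) (proj₂ starts-with-ab)) (a ∷ pre , refl))
        where
          p = a ∷ pre ++ x ∷ y ∷ []
          prefix : a ∷ b ∷ rest ≡ p ++ suf
          prefix = cong (a ∷_) (trans eq (sym (++-assoc pre (x ∷ y ∷ []) suf)))
          bounded-p : Linked (Edge≤ (φ a b)) p
          bounded-p = Linked-++⁻ˡ p (subst (Linked _) prefix bounded)
          unique-p : Unique p
          unique-p = Unique-++⁻ˡ p (subst Unique prefix unique)
          starts-with-ab : ∃ λ rest′ → pre ++ x ∷ y ∷ [] ≡ b ∷ rest′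
          starts-with-ab = head≡just⇒∷ (pre ++ x ∷ y ∷ [])
            (trans (head-++-∷ pre x (y ∷ []) (y ∷ suf)) (cong head (sym eq)))
          a∉ : a ∉ₗ b ∷ rest
          a∉ = Unique.Unique[x∷xs]⇒x∉xs unique
          x∈ : x ∈ₗ b ∷ rest
          x∈ = subst (x ∈ₗ_) (sym eq) (∈-++⁺ʳ pre (here refl))
          y∈ : y ∈ₗ b ∷ rest
          y∈ = subst (y ∈ₗ_) (sym eq) (∈-++⁺ʳ pre (there (here refl)))
          no-larger-label : ¬ (∃ λ x′ → ∃ λ y′ → Consecutive x′ y′ p × φ a b < φ x′ y′)
          no-larger-label (_ , _ , (pre′ , _ , p≡) , ab<x′y′) =
            <⇒≱ ab<x′y′ (proj₂ (Linked-infix pre′ (subst (Linked _) p≡ bounded-p)))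

-- Maximal cliques of Gᶜ and the clique tree

module CliqueEnumeration {n} (G : Graph n) {m} {K : Fin m → Subset n}
                         (enumeration : MaxCliqueEnum (complement G) m K) where

  open MaximalCliques (complement G)

  K-injective : ∀ {i j} → K i ≡ K j → i ≡ j
  K-injective = proj₁ enumeration

  K-maxClique : ∀ k → IsMaxClique (complement G) (K k)
  K-maxClique = proj₁ (proj₂ enumeration)

  clique-∋ : ∀ x → ∃ λ k → x ∈ K k
  clique-∋ x with maxClique-∋ x
  ... | S , maxClique , x∈S with proj₂ (proj₂ enumeration) S maxClique
  ... | k , refl = k , x∈S

  clique-∋-nonadjacent : ∀ {x y} → x ≢ y → adj G x y ≡ false → ∃ λ k → x ∈ K k × y ∈ K k
  clique-∋-nonadjacent x≢y nonadjacent with maxClique-∋-edge (complement-E⁺ G x≢y nonadjacent)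
  ... | S , maxClique , x∈S , y∈S with proj₂ (proj₂ enumeration) S maxClique
  ... | k , refl = k , x∈S , y∈S

  clique-¬E : ∀ {k x y} → x ∈ K k → y ∈ K k → ¬ E G x y
  clique-¬E {k} = clique-complement⇒¬E G (proj₁ (K-maxClique k))

  distinct-cliques-E : ∀ {i j} → i ≢ j → ∃₂ λ u v → u ∈ K i × v ∈ K j × E G u v
  distinct-cliques-E i≢j with maxCliques-≢⇒nonEdge (K-maxClique _) (K-maxClique _) (i≢j ∘ K-injective)
  ... | u , v , u∈ , v∈ , u≢v , ¬E = u , v , u∈ , v∈ , ¬complement-E⇒E G u≢v ¬E

AtMostTwoMaxIndependent : ∀ {n} → Graph n → Set
AtMostTwoMaxIndependent G =
  ∀ v S₁ S₂ S₃ → IsMaxIndependent G S₁ → IsMaxIndependent G S₂ → IsMaxIndependent G S₃ →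
  v ∈ S₁ → v ∈ S₂ → v ∈ S₃ → S₁ ≡ S₂ ⊎ S₁ ≡ S₃ ⊎ S₂ ≡ S₃

module CliqueTree {n} (G : Graph n) (at-most-two : AtMostTwoMaxIndependent G)
                  {m} {K : Fin m → Subset n} {T : Graph m} (clique-tree : IsCliqueTree (complement G) K T) where

  open CliqueEnumeration G (proj₁ clique-tree) public

  path-in-two-cliques : ∀ {x i k p} → x ∈ K i → x ∈ K k → i ≢ k → PathBetween T i k p →
                        ∀ {l} → l ∈ₗ p → l ≡ i ⊎ l ≡ k
  path-in-two-cliques {x} {i} {k} {p} x∈i x∈k i≢k path {l} l∈p
    with at-most-two x (K i) (K k) (K l) (independent i) (independent k) (independent l) x∈i x∈k
                     (proj₂ (proj₂ clique-tree) i k i≢k p path l l∈p (x∈p∩q⁺ (x∈i , x∈k)))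
    where independent = λ j → maxClique-complement⇒maxIndependent G (K-maxClique j)
  ... | inj₁ Ki≡Kk        = contradiction (K-injective Ki≡Kk) i≢k
  ... | inj₂ (inj₁ Ki≡Kl) = inj₁ (sym (K-injective Ki≡Kl))
  ... | inj₂ (inj₂ Kk≡Kl) = inj₂ (sym (K-injective Kk≡Kl))

  cliques-∋-adjacent : ∀ {x i k} → x ∈ K i → x ∈ K k → i ≢ k → E T i k
  cliques-∋-adjacent {x} {i} {k} x∈i x∈k i≢k with proj₁ (proj₁ (proj₂ clique-tree)) i k
  ... | p , path@(linked , unique , head≡ , last≡) with head≡just⇒∷ p head≡
  ... | []       , refl = contradiction (just-injective last≡) i≢k
  ... | y ∷ rest , refl with path-in-two-cliques x∈i x∈k i≢k path (there (here refl))
  ...   | inj₁ refl = contradiction (here refl) (Unique.Unique[x∷xs]⇒x∉xs unique)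
  ...   | inj₂ refl = Linked.head linked

-- The upper bound

module BicliqueCover {n} (G : Graph n) (at-most-two : AtMostTwoMaxIndependent G)
                     {m} {K : Fin m → Subset n} {T : Graph m} (clique-tree : IsCliqueTree (complement G) K T)
                     {r} {φ : Fin m → Fin m → ℕ} (ranking : IsEdgeRanking T r φ) (ρ : Fin m) where

  open CliqueTree G at-most-two {m} {K} {T} clique-tree
  open Labelling φ
  open EdgeRanking T ranking

  private
    tree : IsTree T
    tree = proj₁ (proj₂ clique-tree)

    φ-sym : ∀ {u v} → E T u v → φ u v ≡ φ v u
    φ-sym {u} {v} e = proj₁ (proj₁ ranking u v e)

  open TreeParity T tree φ φ-sym ρ

  module Separation {u v} (uv : E G u v) where

    β : Bridge T (λ k → u ∈ K k) (λ k → v ∈ K k)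
    β = bridge (proj₁ tree) (λ k → u ∈? K k) (λ k → v ∈? K k) (λ k u∈ v∈ → clique-¬E u∈ v∈ uv)
               (proj₂ (clique-∋ u)) (proj₂ (clique-∋ v))

    open Bridge β public

    q : List (Fin m)
    q = start ∷ via ∷ʳ end

    q-unique : Unique q
    q-unique = proj₁ (proj₂ path)

    open MaxLabelSplit (max-label-split start via end)

    M : ℕ
    M = φ c d

    q-bounded : Linked (Edge≤ M) q
    q-bounded = Linked.zip (proj₁ path , bounded)

    cdsuf-bounded : Linked (Edge≤ M) (c ∷ d ∷ suf)
    cdsuf-bounded = Linked-++⁻ʳ pre (subst (Linked (Edge≤ M)) split q-bounded)

    cdsuf-unique : Unique (c ∷ d ∷ suf)
    cdsuf-unique = Unique-++⁻ʳ pre (subst Unique split q-unique)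

    cdsuf⊆q : ∀ {l} → l ∈ₗ c ∷ d ∷ suf → l ∈ₗ q
    cdsuf⊆q l∈ = subst (_ ∈ₗ_) (sym split) (∈-++⁺ʳ pre l∈)

    cdsuf-last : last (c ∷ d ∷ suf) ≡ just end
    cdsuf-last =
      trans (sym (last-++-∷ pre c (d ∷ suf))) (trans (cong last (sym split)) (last-∷ʳ (start ∷ via) end))

    parity-q : parity M q ≡ true
    parity-q = begin
      parity M q
        ≡⟨ cong (parity M) split ⟩
      parity M (pre ++ c ∷ d ∷ suf)
        ≡⟨ parity-++-∷ M pre c (d ∷ suf) ⟩
      parity M (pre ∷ʳ c) xor (labelled M c d xor parity M (d ∷ suf))
        ≡⟨ cong₂ _xor_ before (cong₂ _xor_ at after) ⟩
      false xor (true xor false)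
        ∎
      where
        open ≡-Reasoning
        before = parity-unlabelled M (Linked.map <⇒≢ below-before)
        at     = dec-true (M ℕ.≟ M) refl
        after  = parity-unlabelled M (first-max-label-unique suf cdsuf-bounded cdsuf-unique)

    π-end : π M end ≡ not (π M start)
    π-end = begin
      π M end                  ≡⟨ π-walk M (via ∷ʳ end) (proj₁ path) (last-∷ʳ (start ∷ via) end) ⟩
      π M start xor parity M q ≡⟨ cong (π M start xor_) parity-q ⟩
      π M start xor true       ≡⟨ Bool.xor-comm (π M start) true ⟩
      not (π M start)          ∎
      where open ≡-Reasoning

    start-pendant-unlabelled : ∀ {k} → k ∉ₗ q → E T start k → φ start k ≢ M
    start-pendant-unlabelled {k} k∉q e start-k≡M =
      Linked-infix pre (subst (Linked _) split M-not-on-q) (sym k-start≡M)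
      where
        k-start≡M : φ k start ≡ M
        k-start≡M = trans (sym (φ-sym e)) start-k≡M
        M-not-on-q : Linked (λ x y → φ x y ≢ φ k start) q
        M-not-on-q = first-max-label-unique (via ∷ʳ end)
          (subst (λ N → Linked (Edge≤ N) (k ∷ q)) (sym k-start≡M)
                 ((E-sym T e , ≤-reflexive k-start≡M) ∷ q-bounded))
          (All.tabulate (λ l∈q k≡l → k∉q (subst (_∈ₗ q) (sym k≡l) l∈q)) ∷ q-unique)

    end-pendant-unlabelled : ∀ {k} → k ∉ₗ q → E T end k → φ end k ≢ M
    end-pendant-unlabelled {k} k∉q e end-k≡M = last-edge-unlabelled (Linked-∷ʳ⁻ d suf M-not-after-cd)
      where
        M-not-after-cd : Linked (λ x y → φ x y ≢ M) (d ∷ suf ∷ʳ k)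
        M-not-after-cd = first-max-label-unique (suf ∷ʳ k)
          (Linked-∷ʳ⁺ (c ∷ d ∷ suf) cdsuf-bounded cdsuf-last (e , ≤-reflexive end-k≡M))
          (Unique-∷ʳ⁺ cdsuf-unique (k∉q ∘ cdsuf⊆q))
        last-edge-unlabelled : ¬ (∃ λ w → last (d ∷ suf) ≡ just w × φ w k ≢ M)
        last-edge-unlabelled (w , last≡w , w-k≢M) =
          w-k≢M (subst (λ x → φ x k ≡ M) (just-injective (trans (sym cdsuf-last) last≡w)) end-k≡M)

    M-in-range : 1 ≤ M × M ≤ r
    M-in-range = proj₂ (proj₁ ranking c d (proj₁ (Linked.head cdsuf-bounded)))

    u-side : ∀ k → u ∈ K k → π M k ≡ π M start
    u-side k u∈k = [ cong (π M) , k≢start⇒same-side ]′ (toSum (k ≟ start))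
      where
        k≢start⇒same-side : k ≢ start → π M k ≡ π M start
        k≢start⇒same-side k≢start =
          π-unlabelled-edge e (start-pendant-unlabelled (k≢start ∘ flip U-only-at-start u∈k) e)
          where e = cliques-∋-adjacent start∈U u∈k (k≢start ∘ sym)

    v-side : ∀ k → v ∈ K k → π M k ≡ π M end
    v-side k v∈k = [ cong (π M) , k≢end⇒same-side ]′ (toSum (k ≟ end))
      where
        k≢end⇒same-side : k ≢ end → π M k ≡ π M end
        k≢end⇒same-side k≢end =
          π-unlabelled-edge e (end-pendant-unlabelled (k≢end ∘ flip V-only-at-end v∈k) e)
          where e = cliques-∋-adjacent end∈V v∈k (k≢end ∘ sym)

  -- Edge labels range over 1, …, r; biclique t handles the label t + 1.
  label : Fin r → ℕ
  label t = suc (toℕ t)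

  label-onto : ∀ {M} → 1 ≤ M → M ≤ r → ∃ λ t → label t ≡ M
  label-onto {suc M} _ M<r = fromℕ< M<r , cong suc (toℕ-fromℕ< M<r)

  OnSide : Fin r → Bool → Fin n → Set
  OnSide t b x = ∀ k → x ∈ K k → π (label t) k ≡ b

  onSide? : ∀ t b → Decidable (OnSide t b)
  onSide? t b x = all? λ k → x ∈? K k →-dec π (label t) k Bool.≟ b

  A B : Fin r → Subset n
  A t = subsetOf (onSide? t false)
  B t = subsetOf (onSide? t true)

  A×B⊆E : ∀ t x y → x ∈ A t → y ∈ B t → E G x y
  A×B⊆E t x y x∈A y∈B = decidable-stable (adj G x y Bool.≟ true) λ ¬E → opposite-sides (shared-clique ¬E)
    where
      shared-clique : ¬ E G x y → ∃ λ k → x ∈ K k × y ∈ K k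
      shared-clique ¬E with x ≟ y
      ... | no x≢y   = clique-∋-nonadjacent x≢y (Bool.¬-not ¬E)
      ... | yes refl with clique-∋ x
      ...   | k , x∈k = k , x∈k , x∈k
      opposite-sides : ¬ (∃ λ k → x ∈ K k × y ∈ K k)
      opposite-sides (k , x∈k , y∈k) =
        contradiction (trans (sym (∈-subsetOf⁻ (onSide? t false) x∈A k x∈k)) (∈-subsetOf⁻ (onSide? t true) y∈B k y∈k))
                      λ ()

  E⊆A×B : ∀ u v → E G u v → ∃ λ t → (u ∈ A t × v ∈ B t) ⊎ (v ∈ A t × u ∈ B t)
  E⊆A×B u v uv = t , sides (π M start) refl
    where
      open Separation uv
      t-for-M : ∃ λ t → label t ≡ M
      t-for-M = label-onto (proj₁ M-in-range) (proj₂ M-in-range)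
      t = proj₁ t-for-M
      on : ∀ {x b} → (∀ k → x ∈ K k → π M k ≡ b) → x ∈ subsetOf (onSide? t b)
      on {b = b} side = ∈-subsetOf⁺ (onSide? t b) λ k x∈k →
        subst (λ N → π N k ≡ b) (sym (proj₂ t-for-M)) (side k x∈k)
      sides : ∀ b → π M start ≡ b → (u ∈ A t × v ∈ B t) ⊎ (v ∈ A t × u ∈ B t)
      sides false eq = inj₁ (on (λ k u∈k → trans (u-side k u∈k) eq) ,
                             on (λ k v∈k → trans (v-side k v∈k) (trans π-end (cong not eq))))
      sides true  eq = inj₂ (on (λ k v∈k → trans (v-side k v∈k) (trans π-end (cong not eq))) ,
                             on (λ k u∈k → trans (u-side k u∈k) eq))

  isBicliqueCover : IsBicliqueCover G r A B
  isBicliqueCover = A×B⊆E , E⊆A×B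

ranking⇒bicliqueCover : ∀ {n} (G : Graph n) → AtMostTwoMaxIndependent G →
                        ∀ {m} {K : Fin m → Subset n} {T : Graph m} → IsCliqueTree (complement G) K T →
                        ∀ {r φ} → IsEdgeRanking T r φ → ∃₂ λ A B → IsBicliqueCover G r A B
ranking⇒bicliqueCover G _ {zero} {K} clique-tree _ =
  (λ _ → ∅) , (λ _ → ∅) , (λ _ x → ⊥-elim (no-vertex x)) , λ u → ⊥-elim (no-vertex u)
  where
    no-vertex : ¬ Fin _
    no-vertex x with CliqueEnumeration.clique-∋ G {K = K} (proj₁ clique-tree) x
    ... | () , _
ranking⇒bicliqueCover G at-most-two {suc _} {K} {T} clique-tree ranking = A , B , isBicliqueCover
  where open BicliqueCover G at-most-two {K = K} {T} clique-tree ranking zero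

-- The lower bound

indicator : ∀ {P : Set} → Dec P → Fin 2
indicator (yes _) = suc zero
indicator (no _)  = zero

indicator-≡ : ∀ {P Q : Set} (p? : Dec P) (q? : Dec Q) → indicator p? ≡ indicator q? → P → Q
indicator-≡ (yes _) (yes q) _  _ = q
indicator-≡ (no ¬p) _       _  p = contradiction p ¬p

injective-code⇒≤2^ : ∀ {m k} (code : Fin m → Fin k → Fin 2) →
                     (∀ i j → (∀ t → code i t ≡ code j t) → i ≡ j) → m ≤ 2 ^ k
injective-code⇒≤2^ code code-injective =
  injective⇒≤ {f = funToFin ∘ code} λ {i} {j} eq → code-injective i j λ t → begin
    code i t                       ≡⟨ finToFun-funToFin (code i) t ⟨
    finToFun (funToFin (code i)) t ≡⟨ cong (λ c → finToFun c t) eq ⟩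
    finToFun (funToFin (code j)) t ≡⟨ finToFun-funToFin (code j) t ⟩
    code j t                       ∎
  where open ≡-Reasoning

module LowerBound {n} (G : Graph n) {m} {K : Fin m → Subset n}
                  (enumeration : MaxCliqueEnum (complement G) m K) where

  open CliqueEnumeration G enumeration

  cliques≤2^cover : ∀ {k A B} → IsBicliqueCover G k A B → m ≤ 2 ^ k
  cliques≤2^cover {k} {A} {B} (A×B⊆E , E⊆A×B) = injective-code⇒≤2^ code code-injective
    where
      meets? : ∀ i t → Dec (∃ λ x → x ∈ K i × x ∈ A t)
      meets? i t = any? λ x → x ∈? K i ×-dec x ∈? A t

      code : Fin m → Fin k → Fin 2
      code i t = indicator (meets? i t)

      ¬meets : ∀ {j t v} → v ∈ K j → v ∈ B t → ¬ (∃ λ x → x ∈ K j × x ∈ A t)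
      ¬meets v∈j v∈B (x , x∈j , x∈A) = clique-¬E x∈j v∈j (A×B⊆E _ x _ x∈A v∈B)

      code-injective : ∀ i j → (∀ t → code i t ≡ code j t) → i ≡ j
      code-injective i j same with i ≟ j
      ... | yes i≡j = i≡j
      ... | no i≢j with distinct-cliques-E i≢j
      ... | u , v , u∈i , v∈j , uv with E⊆A×B u v uv
      ... | t , inj₁ (u∈A , v∈B) =
        contradiction (indicator-≡ (meets? i t) (meets? j t) (same t) (u , u∈i , u∈A)) (¬meets v∈j v∈B)
      ... | t , inj₂ (v∈A , u∈B) =
        contradiction (indicator-≡ (meets? j t) (meets? i t) (sym (same t)) (v , v∈j , v∈A)) (¬meets u∈i u∈B)

  ⌈log₂cliques⌉≤cover : ∀ {k A B} → IsBicliqueCover G k A B → ⌈log₂ m ⌉ ≤ k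
  ⌈log₂cliques⌉≤cover {k} cover =
    subst (⌈log₂ m ⌉ ≤_) (⌈log₂2^n⌉≡n k) (⌈log₂⌉-mono-≤ {m} {2 ^ k} (cliques≤2^cover cover))

mainTheorem11 : ∀ {n} (G : Graph n) → Chordal (complement G) →
    (∀ v S₁ S₂ S₃ → IsMaxIndependent G S₁ → IsMaxIndependent G S₂ → IsMaxIndependent G S₃ →
      v ∈ S₁ → v ∈ S₂ → v ∈ S₃ → S₁ ≡ S₂ ⊎ S₁ ≡ S₃ ⊎ S₂ ≡ S₃) →
    (m : ℕ) (K : Fin m → Subset n) (T : Graph m) →
    IsCliqueTree (complement G) K T →
    EdgeRankingNumber≡ T ⌈log₂ m ⌉ →
    BicliqueCoverNumber≡ G ⌈log₂ m ⌉
mainTheorem11 G _ at-most-two m K T clique-tree ((φ , ranking) , _) =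
  ranking⇒bicliqueCover G at-most-two {m} {K} {T} clique-tree ranking ,
  λ _ _ _ → LowerBound.⌈log₂cliques⌉≤cover G {m} {K} (proj₁ clique-tree)
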